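{- Let $\mathbf A$ be an algebra with a ternary near unanimity term $t$, i.e. $t(x,x,y)=t(x,y,x)=t(y,x,x)=x$. Then for every $n\geq2$, $\mathbf A$ satisfies the loop condition of the cone with $n$ cycle vertices: that is, whenever $\mathbb G$ is a digraph compatible with $\mathbf A$ and containing elements $a,b,c_1,\dots,c_n$ with edges $c_1\to c_2\to\cdots\to c_n\to c_1$, $a\to c_i$ for all $1\leq i\leq n$, and $b\to a$, the digraph $\mathbb G$ has a loop; equivalently, $\mathbf A$ has a term $s$ satisfying $s(x_1,\dots,x_m)=s(y_1,\dots,y_m)$ where $(x_1,y_1),\dots,(x_m,y_m)$ lists the edges of the cone.
   Context: A digraph is a set with a binary relation $G$; a loop is an edge $(v,v)$. An algebra is compatible with a digraph $(A,G)$ if each basic $k$-ary operation $f$ satisfies $(f(a_1,\dots,a_k),f(b_1,\dots,b_k))\in G$ whenever all $(a_i,b_i)\in G$. The cone with $n\geq2$ cycle vertices is the digraph on vertices $a,b,c_1,\dots,c_n$ with edges $c_i\to c_{i+1}$ ($1\le i<n$), $c_n\to c_1$, $a\to c_i$ ($1\le i\le n$) and $b\to a$. -}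

module Defs where

open import Data.Nat using (ℕ; suc)
open import Data.Fin using (Fin; zero; suc; inject₁; fromℕ)
open import Data.Product using (∃; _×_)
open import Relation.Binary.PropositionalEquality using (_≡_)

record Signature : Set₁ where
  field
    Op    : Set
    arity : Op → ℕ

open Signature public

record Algebra (σ : Signature) : Set₁ where
  field
    Carrier : Set
    ⟦_⟧     : (f : Op σ) → (Fin (arity σ f) → Carrier) → Carrier

open Algebra public

data Term (σ : Signature) (X : Set) : Set where
  var  : X → Term σ X
  node : (f : Op σ) → (Fin (arity σ f) → Term σ X) → Term σ X

eval : {σ : Signature} (𝐀 : Algebra σ) {X : Set} → Term σ X → (X → Carrier 𝐀) → Carrier 𝐀
eval 𝐀 (var x)     ρ = ρ x
eval 𝐀 (node f ts) ρ = ⟦ 𝐀 ⟧ f (λ i → eval 𝐀 (ts i) ρ)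

ternary : {σ : Signature} (𝐀 : Algebra σ) → Term σ (Fin 3) → Carrier 𝐀 → Carrier 𝐀 → Carrier 𝐀 → Carrier 𝐀
ternary 𝐀 t x y z = eval 𝐀 t ρ
  where
  ρ : Fin 3 → Carrier 𝐀
  ρ zero             = x
  ρ (suc zero)       = y
  ρ (suc (suc zero)) = z

IsNUTerm : {σ : Signature} (𝐀 : Algebra σ) → Term σ (Fin 3) → Set
IsNUTerm 𝐀 t = ∀ x y →
  (ternary 𝐀 t x x y ≡ x) × (ternary 𝐀 t x y x ≡ x) × (ternary 𝐀 t y x x ≡ x)

Digraph : Set → Set₁
Digraph A = A → A → Set

Compatible : {σ : Signature} (𝐀 : Algebra σ) → Digraph (Carrier 𝐀) → Set
Compatible {σ} 𝐀 G = ∀ (f : Op σ) (as bs : Fin (arity σ f) → Carrier 𝐀) →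
  (∀ i → G (as i) (bs i)) → G (⟦ 𝐀 ⟧ f as) (⟦ 𝐀 ⟧ f bs)

-- The cone with n = m + 2 cycle vertices maps into G via a, b, c_1..c_n
-- (vertices c : Fin n → A, with c zero = c_1 and c (fromℕ (suc m)) = c_n).
ContainsCone : {A : Set} → Digraph A → (m : ℕ) → A → A → (Fin (suc (suc m)) → A) → Set
ContainsCone G m a b c =
  (∀ (i : Fin (suc m)) → G (c (inject₁ i)) (c (suc i))) ×
  G (c (fromℕ (suc m))) (c zero) ×
  (∀ (i : Fin (suc (suc m))) → G a (c i)) ×
  G b a

HasLoop : {A : Set} → Digraph A → Set
HasLoop {A} G = ∃ λ (v : A) → G v v

module Submission where

-- Every term operation of 𝐀 preserves a compatible digraph G, so an NU term
-- gives a ternary NU polymorphism T of G.  Walking around the cycle yields a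
-- sequence s₀ → s₁ → s₂ → ⋯ with s_{m+2} = s₀ and a → sⱼ for all j.  Put
--   L₀ i = sᵢ,    L_{k+1} i = T (L_k i) a (L_k (i+1)).
-- Using the NU laws one shows
--   (1) L_k i → s_{i+1+d}  for every d ≤ k, and
--   (2) if x → s_{i+d} for every d ≤ k, then x → L_k i,
-- where (2) rests on the absorption step  x → u, x → w ⟹ x → T u a w,
-- obtained from T x b x = x and b → a.  For X = L_{m+1} 0, (1) gives
-- X → s₁, …, s_{m+2} = s₀, i.e. X → every vertex of the cycle; then (2)
-- gives X → L_m 0 and X → L_m 1, and absorption gives the loop X → X.

open import Defs
open import Data.Nat using (ℕ; suc)
open import Data.Fin using (Fin)
open import Data.Product using (Σ)

open import Data.Nat using (zero; _+_; _≤_; z≤n; s≤s; s≤s⁻¹)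
open import Data.Nat.Properties using (+-suc; +-identityʳ; m≤n⇒m≤1+n; ≤-refl)
open import Data.Fin using (zero; suc; toℕ; inject₁; fromℕ)
open import Data.Fin.Properties using (toℕ-fromℕ; toℕ-inject₁)
open import Data.Fin.Induction using (<-weakInduction)
open import Data.Product using (_,_)
open import Relation.Binary.PropositionalEquality
  using (_≡_; refl; sym; cong; subst; module ≡-Reasoning)

record NUPolymorphism {A : Set} (G : Digraph A) : Set where
  field
    op        : A → A → A → A
    preserves : ∀ {x₁ x₂ x₃ y₁ y₂ y₃} →
                G x₁ y₁ → G x₂ y₂ → G x₃ y₃ → G (op x₁ x₂ x₃) (op y₁ y₂ y₃)
    nu₁       : ∀ x y → op x x y ≡ x
    nu₂       : ∀ x y → op x y x ≡ x
    nu₃       : ∀ x y → op y x x ≡ x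

module _ {σ : Signature} (𝐀 : Algebra σ) (G : Digraph (Carrier 𝐀))
         (compatible : Compatible 𝐀 G) where

  eval-preserves : {X : Set} (s : Term σ X) (ρ ρ′ : X → Carrier 𝐀) →
                   (∀ x → G (ρ x) (ρ′ x)) → G (eval 𝐀 s ρ) (eval 𝐀 s ρ′)
  eval-preserves (var x)     ρ ρ′ edges = edges x
  eval-preserves (node f ts) ρ ρ′ edges =
    compatible f _ _ (λ i → eval-preserves (ts i) ρ ρ′ edges)

  nu-term-polymorphism : Σ (Term σ (Fin 3)) (IsNUTerm 𝐀) → NUPolymorphism G
  nu-term-polymorphism (t , nu) = record
    { op        = ternary 𝐀 t
    ; preserves = λ e₁ e₂ e₃ → eval-preserves t _ _ λ
        { zero → e₁ ; (suc zero) → e₂ ; (suc (suc zero)) → e₃ }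
    ; nu₁       = λ x y → let (p , _ , _) = nu x y in p
    ; nu₂       = λ x y → let (_ , p , _) = nu x y in p
    ; nu₃       = λ x y → let (_ , _ , p) = nu x y in p
    }

module ConeOverClosedWalk
  {A : Set} {G : Digraph A} (N : NUPolymorphism G)
  (a b : A) (b→a : G b a)
  (s : ℕ → A) (walk : ∀ j → G (s j) (s (suc j))) (a→s : ∀ j → G a (s j))
  where

  open NUPolymorphism N renaming (op to T)

  -- Anything with edges to u and w has an edge to T u a w, as T x b x = x.
  absorb : ∀ {x u w} → G x u → G x w → G x (T u a w)
  absorb {x} x→u x→w = subst (λ y → G y _) (nu₂ x b) (preserves x→u b→a x→w)

  level : ℕ → ℕ → A
  level zero    i = s i
  level (suc k) i = T (level k i) a (level k (suc i))

  level→walk : ∀ k i d → d ≤ k → G (level k i) (s (suc (i + d)))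
  level→walk zero    i zero    z≤n =
    subst (λ j → G (s i) (s (suc j))) (sym (+-identityʳ i)) (walk i)
  level→walk (suc k) i zero    _       =
    subst (G (level (suc k) i)) (nu₁ _ _)
      (preserves (level→walk k i 0 z≤n) (a→s _) (level→walk k (suc i) 0 z≤n))
  level→walk (suc k) i (suc d) (s≤s d≤k) =
    subst (G (level (suc k) i)) (nu₃ _ _)
      (preserves (level→walk k i 0 z≤n) (a→s _)
        (subst (λ j → G (level k (suc i)) (s (suc j))) (sym (+-suc i d))
          (level→walk k (suc i) d d≤k)))

  walk→level : ∀ k i x → (∀ d → d ≤ k → G x (s (i + d))) → G x (level k i)
  walk→level zero    i x x→s = subst (λ j → G x (s j)) (+-identityʳ i) (x→s 0 z≤n)
  walk→level (suc k) i x x→s =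
    absorb (walk→level k i x λ d d≤k → x→s d (m≤n⇒m≤1+n d≤k))
           (walk→level k (suc i) x λ d d≤k →
              subst (λ j → G x (s j)) (+-suc i d) (x→s (suc d) (s≤s d≤k)))

  loop : (m : ℕ) → s (suc (suc m)) ≡ s zero → HasLoop G
  loop m closed = X , absorb (walk→level m 0 X λ d d≤m → X→s d (m≤n⇒m≤1+n d≤m))
                             (walk→level m 1 X λ d d≤m → X→s (suc d) (s≤s d≤m))
    where
    X : A
    X = level (suc m) 0

    X→s : ∀ j → j ≤ suc m → G X (s j)
    X→s zero    _   = subst (G X) closed (level→walk (suc m) 0 (suc m) ≤-refl)
    X→s (suc j) j<n = level→walk (suc m) 0 j (m≤n⇒m≤1+n (s≤s⁻¹ j<n))

data Position {k : ℕ} : Fin (suc k) → Set where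
  inner : (l : Fin k) → Position (inject₁ l)
  last  : Position (fromℕ k)

position : ∀ {k} (i : Fin (suc k)) → Position i
position {zero}  zero    = last
position {suc k} zero    = inner zero
position {suc k} (suc i) with position i
... | inner l = inner (suc l)
... | last    = last

next : ∀ {k} → Fin (suc k) → Fin (suc k)
next i with position i
... | inner l = suc l
... | last    = zero

position-inject₁ : ∀ {k} (l : Fin k) → position (inject₁ l) ≡ inner l
position-inject₁ {suc k} zero    = refl
position-inject₁ {suc k} (suc l) rewrite position-inject₁ l = refl

position-fromℕ : ∀ k → position (fromℕ k) ≡ last
position-fromℕ zero    = refl
position-fromℕ (suc k) rewrite position-fromℕ k = refl

next-inject₁ : ∀ {k} (l : Fin k) → next (inject₁ l) ≡ suc l
next-inject₁ l rewrite position-inject₁ l = refl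

next-fromℕ : ∀ k → next (fromℕ k) ≡ zero
next-fromℕ k rewrite position-fromℕ k = refl

walkFrom0 : ∀ {k} → ℕ → Fin (suc k)
walkFrom0 zero    = zero
walkFrom0 (suc j) = next (walkFrom0 j)

walkFrom0-toℕ : ∀ {k} (i : Fin (suc k)) → walkFrom0 (toℕ i) ≡ i
walkFrom0-toℕ = <-weakInduction (λ i → walkFrom0 (toℕ i) ≡ i) refl step
  where
  open ≡-Reasoning
  step : ∀ {k} (l : Fin k) → walkFrom0 (toℕ (inject₁ l)) ≡ inject₁ l →
         walkFrom0 (toℕ (suc l)) ≡ suc l
  step l at-l = begin
    next (walkFrom0 (toℕ l))           ≡⟨ cong (λ j → next (walkFrom0 j)) (sym (toℕ-inject₁ l)) ⟩
    next (walkFrom0 (toℕ (inject₁ l))) ≡⟨ cong next at-l ⟩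
    next (inject₁ l)                   ≡⟨ next-inject₁ l ⟩
    suc l                              ∎

walkFrom0-period : ∀ k → walkFrom0 {k} (suc k) ≡ zero
walkFrom0-period k = begin
  next (walkFrom0 k)                ≡⟨ cong (λ j → next (walkFrom0 j)) (sym (toℕ-fromℕ k)) ⟩
  next (walkFrom0 (toℕ (fromℕ k)))  ≡⟨ cong next (walkFrom0-toℕ (fromℕ k)) ⟩
  next (fromℕ k)                    ≡⟨ next-fromℕ k ⟩
  zero                              ∎
  where open ≡-Reasoning

cone-cycle-edge : ∀ {A : Set} (G : Digraph A) {m a b} (c : Fin (suc (suc m)) → A) →
                  ContainsCone G m a b c →
                  ∀ i → G (c i) (c (next i))
cone-cycle-edge G c (cycle , closing , _ , _) i with position i
... | inner l = cycle l
... | last    = closing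

mainTheorem20 : {σ : Signature} (𝐀 : Algebra σ) →
    Σ (Term σ (Fin 3)) (IsNUTerm 𝐀) →
    (m : ℕ) (G : Digraph (Carrier 𝐀)) → Compatible 𝐀 G →
    (a b : Carrier 𝐀) (c : Fin (suc (suc m)) → Carrier 𝐀) →
    ContainsCone G m a b c → HasLoop G
mainTheorem20 𝐀 nu-term m G compatible a b c cone@(_ , _ , a→c , b→a) =
  ConeOverClosedWalk.loop (nu-term-polymorphism 𝐀 G compatible nu-term) a b b→a
    (λ j → c (walkFrom0 j)) (λ j → cone-cycle-edge G c cone (walkFrom0 j))
    (λ j → a→c (walkFrom0 j)) m (cong c (walkFrom0-period (suc m)))
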